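{- Fix an integer $\ell\geq1$. Then $$\lim_{c\to\infty}\frac{\#\{\varphi_{(p-1)^\ell,c}(x)\in\mathbb{Z}[x]:\ 5\leq p\leq c\ \text{prime and}\ Y_c^{(2)}(p)=0\}}{\#\{\varphi_{(p-1)^\ell,c}(x)\in\mathbb{Z}[x]:\ 5\leq p\leq c\ \text{prime}\}}=1.$$
   Context: For a prime $p$, an integer $\ell\geq1$ and $c\in\mathbb{Z}\subset\mathbb{Z}_p$, let $\varphi_{(p-1)^\ell,c}(x)=x^{(p-1)^\ell}+c$ and $Y_c^{(2)}(p)=\#\{z\in\mathbb{Z}_p/p\mathbb{Z}_p:\ \varphi_{(p-1)^\ell,c}(z)-z\not\equiv0\pmod{p\mathbb{Z}_p},\ \varphi_{(p-1)^\ell,c}^2(z)-z\equiv0\pmod{p\mathbb{Z}_p}\}$, where $\varphi^2=\varphi\circ\varphi$. For fixed $c$ the polynomials counted are indexed by the primes $p$ with $5\leq p\leq c$. -}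

module Defs where

open import Data.Nat using (ℕ; zero; suc; _+_; _^_; _∸_; _≤?_; _%_)
open import Data.Nat.Properties using (_≟_)
open import Data.Nat.Primality using (prime?)
open import Data.List using (List; length; filter; upTo)
open import Relation.Nullary using (¬?)
open import Relation.Nullary.Decidable using (_×-dec_)

φ : (p ℓ c : ℕ) → ℕ → ℕ
φ p ℓ c x = x ^ ((p ∸ 1) ^ ℓ) + c

-- Y_c^{(2)}(p): number of residues z ∈ {0,…,p-1} with
--   φ(z) - z ≢ 0 (mod p)  and  φ(φ(z)) - z ≡ 0 (mod p).
-- Congruence mod p is tested via remainders; p = 0 never occurs (p ≥ 5).
Y2 : (ℓ c p : ℕ) → ℕ
Y2 ℓ c zero = 0
Y2 ℓ c (suc n) =
  length (filter (λ z → ¬? ((φ p ℓ c z % p) ≟ (z % p))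
                        ×-dec ((φ p ℓ c (φ p ℓ c z) % p) ≟ (z % p)))
                 (upTo p))
  where p = suc n

-- primes p with 5 ≤ p ≤ c (each gives a distinct polynomial φ_{(p-1)^ℓ,c})
primesIn5c : ℕ → List ℕ
primesIn5c c = filter (λ p → prime? p ×-dec (5 ≤? p)) (upTo (suc c))

denom : ℕ → ℕ
denom c = length (primesIn5c c)

numer : ℕ → ℕ → ℕ
numer ℓ c = length (filter (λ p → Y2 ℓ c p ≟ 0) (primesIn5c c))

-- For a prime p ≥ 5, Fermat's little theorem gives z ^ (p - 1) ^ ℓ ≡ 1 (mod p) unless p ∣ z, so
-- modulo p the map φ takes only the values c (on multiples of p) and c + 1 (elsewhere). A point
-- of exact period two therefore forces p ∣ c + 1. At most T such primes lie below T, and those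
-- ≥ T have product ≤ c + 1, so there are at most log_T (c + 1) of them. Erdős's elementary bound
-- π(4 ^ m) ≥ m (every n ≤ x is a² s with s a product of distinct primes ≤ x, so x ≤ √x · 2 ^ π(x))
-- then shows that for T = 16 ^ K the exceptional primes are eventually fewer than a fraction 1/K
-- of all primes 5 ≤ p ≤ c.

module Submission where

module Fermat where

  open import Algebra.Bundles using (Semiring)
  open import Data.Fin using (Fin; zero; suc; toℕ; fromℕ; inject₁)
  open import Data.Fin.Properties using (toℕ-fromℕ; toℕ-inject₁; toℕ<n)
  open import Data.Nat
  open import Data.Nat.Combinatorics
  open import Data.Nat.DivMod using (m/n*n≡m)
  open import Data.Nat.Divisibility
  open import Data.Nat.Primality
  open import Data.Nat.Properties
  open import Data.Nat.Tactic.RingSolver using (solve-∀)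
  open import Data.Product using (∃; _,_)
  open import Function using (_∘_)
  open import Data.Sum using (inj₁; inj₂)
  open import Relation.Binary.PropositionalEquality
  open import Relation.Nullary using (¬_; contradiction)

  import Algebra.Properties.Monoid.Sum as MonoidSum
  import Algebra.Properties.Semiring.Binomial as Binomial
  open import Algebra.Definitions.RawSemiring (Semiring.rawSemiring +-*-semiring)
    using () renaming (_^_ to _^ˢ_; _×_ to _×ˢ_; sum to ∑)

  1<prime : ∀ {p} → Prime p → 1 < p
  1<prime {p} (prime {{nt}} _) = nonTrivial⇒n>1 p {{nt}}

  prime∤! : ∀ {p} → Prime p → ∀ {n} → n < p → ¬ p ∣ n !
  prime∤! pp {zero}  _   p∣1   = <⇒≢ (1<prime pp) (sym (∣1⇒≡1 p∣1))
  prime∤! pp {suc n} n<p p∣n! with euclidsLemma (suc n) (n !) pp p∣n!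
  ... | inj₁ p∣1+n = <⇒≱ n<p (∣⇒≤ p∣1+n)
  ... | inj₂ p∣n!  = prime∤! pp (<-trans (n<1+n n) n<p) p∣n!

  n∣n! : ∀ n .{{_ : NonZero n}} → n ∣ n !
  n∣n! (suc n) = m∣m*n (n !)

  prime∣binomial : ∀ {p k} → Prime p → 0 < k → k < p → p ∣ p C k
  prime∣binomial {p} {k} pp 0<k k<p with euclidsLemma (p C k) ((k !) * (p ∸ k) !) pp p∣C*k!*[p∸k]!
    where
    instance _ = k !* (p ∸ k) !≢0
    instance _ = prime⇒nonZero pp
    C*k!*[p∸k]!≡p! : (p C k) * ((k !) * (p ∸ k) !) ≡ p !
    C*k!*[p∸k]!≡p! = trans (cong (_* ((k !) * (p ∸ k) !)) (nCk≡n!/k![n-k]! (<⇒≤ k<p)))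
                           (m/n*n≡m (k![n∸k]!∣n! (<⇒≤ k<p)))
    p∣C*k!*[p∸k]! : p ∣ (p C k) * ((k !) * (p ∸ k) !)
    p∣C*k!*[p∸k]! = subst (p ∣_) (sym C*k!*[p∸k]!≡p!) (n∣n! p)
  ... | inj₁ p∣C = p∣C
  ... | inj₂ p∣k!*[p∸k]! with euclidsLemma (k !) ((p ∸ k) !) pp p∣k!*[p∸k]!
  ...   | inj₁ p∣k! = contradiction p∣k! (prime∤! pp k<p)
  ...   | inj₂ p∣[p∸k]! = contradiction p∣[p∸k]! (prime∤! pp (∸-monoʳ-< 0<k (<⇒≤ k<p)))

  private
    module ∑ = MonoidSum (Semiring.+-monoid +-*-semiring)

    ^ˢ≡^ : ∀ x n → x ^ˢ n ≡ x ^ n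
    ^ˢ≡^ x zero    = refl
    ^ˢ≡^ x (suc n) = cong (x *_) (^ˢ≡^ x n)

    ×ˢ≡* : ∀ n x → n ×ˢ x ≡ n * x
    ×ˢ≡* zero    x = refl
    ×ˢ≡* (suc n) x = cong (x +_) (×ˢ≡* n x)

    ∣∑ : ∀ {d} n (f : Fin n → ℕ) → (∀ i → d ∣ f i) → d ∣ ∑ f
    ∣∑ zero    f d∣f = _ ∣0
    ∣∑ (suc n) f d∣f = ∣m∣n⇒∣m+n (d∣f zero) (∣∑ n (f ∘ suc) (d∣f ∘ suc))

  freshman's-dream : ∀ {p} → Prime p → ∀ x y → ∃ λ q → (x + y) ^ p ≡ x ^ p + y ^ p + q * p
  freshman's-dream {p@(suc m)} pp x y = quotient p∣middle , (begin
    (x + y) ^ p                                    ≡⟨ sym (^ˢ≡^ (x + y) p) ⟩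
    (x + y) ^ˢ p                                   ≡⟨ B.theorem (*-comm x y) p ⟩
    term zero + ∑ (λ i → term (suc i))             ≡⟨ cong (term zero +_) (∑.sum-init-last (λ i → term (suc i))) ⟩
    term zero + (middle + term (suc (fromℕ m)))    ≡⟨ cong₂ (λ a b → a + (middle + b)) term₀ termₚ ⟩
    y ^ p + (middle + x ^ p)                       ≡⟨ rearrange (y ^ p) middle (x ^ p) ⟩
    x ^ p + y ^ p + middle                         ≡⟨ cong (x ^ p + y ^ p +_) (m∣n⇒n≡quotient*m p∣middle) ⟩
    x ^ p + y ^ p + quotient p∣middle * p          ∎)
    where
    open ≡-Reasoning
    module B = Binomial +-*-semiring x y
    term = B.binomialTerm p
    term≡ : ∀ k → term k ≡ (p C toℕ k) * (x ^ toℕ k * y ^ (p ∸ toℕ k))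
    term≡ k = trans (×ˢ≡* (p C toℕ k) _)
                    (cong ((p C toℕ k) *_) (cong₂ _*_ (^ˢ≡^ x (toℕ k)) (^ˢ≡^ y (p ∸ toℕ k))))
    term₀ : term zero ≡ y ^ p
    term₀ = trans (term≡ zero) (trans (*-identityˡ _) (*-identityˡ _))
    termₚ : term (suc (fromℕ m)) ≡ x ^ p
    termₚ rewrite term≡ (suc (fromℕ m)) | toℕ-fromℕ m | nCn≡1 p | n∸n≡0 m =
      trans (+-identityʳ _) (*-identityʳ _)
    rearrange : ∀ a b c → a + (b + c) ≡ c + a + b
    rearrange = solve-∀
    middle = ∑ (λ (i : Fin m) → term (suc (inject₁ i)))
    p∣middle : p ∣ middle
    p∣middle = ∣∑ m _ λ i → subst (p ∣_) (sym (term≡ (suc (inject₁ i))))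
      (∣m⇒∣m*n _ (prime∣binomial pp z<s (subst (λ j → suc j < p) (sym (toℕ-inject₁ i)) (s<s (toℕ<n i)))))

  fermat : ∀ {p} → Prime p → ∀ x → ∃ λ q → x ^ p ≡ x + q * p
  fermat {p@(suc m)} pp zero = 0 , refl
  fermat {p} pp (suc x) with freshman's-dream pp x 1 | fermat pp x
  ... | q , [x+1]^p≡ | r , x^p≡ = q + r , (begin
    suc x ^ p                  ≡⟨ cong (_^ p) (+-comm 1 x) ⟩
    (x + 1) ^ p                ≡⟨ [x+1]^p≡ ⟩
    x ^ p + 1 ^ p + q * p      ≡⟨ cong₂ (λ a b → a + b + q * p) x^p≡ (^-zeroˡ p) ⟩
    x + r * p + 1 + q * p      ≡⟨ rearrange x r q p ⟩
    suc x + (q + r) * p        ∎)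
    where
    open ≡-Reasoning
    rearrange : ∀ x r q p → x + r * p + 1 + q * p ≡ suc x + (q + r) * p
    rearrange = solve-∀

  fermat-coprime : ∀ {p x} → Prime p → ¬ p ∣ x → ∃ λ q → x ^ (p ∸ 1) ≡ 1 + q * p
  fermat-coprime {p@(suc m)} {x} pp p∤x with fermat pp x
  ... | q , x^p≡ = quotient p∣t , trans x^m≡1+t (cong (1 +_) (m∣n⇒n≡quotient*m p∣t))
    where
    instance
      _ : NonZero x
      _ = ≢-nonZero λ x≡0 → p∤x (subst (p ∣_) (sym x≡0) (p ∣0))
    t = x ^ m ∸ 1
    x^m≡1+t : x ^ m ≡ 1 + t
    x^m≡1+t = sym (m+[n∸m]≡n (m^n>0 x m))
    x*t≡q*p : x * t ≡ q * p
    x*t≡q*p = +-cancelˡ-≡ x (x * t) (q * p) (begin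
      x + x * t       ≡⟨ cong (_+ x * t) (sym (*-identityʳ x)) ⟩
      x * 1 + x * t   ≡⟨ sym (*-distribˡ-+ x 1 t) ⟩
      x * (1 + t)     ≡⟨ cong (x *_) (sym x^m≡1+t) ⟩
      x ^ p           ≡⟨ x^p≡ ⟩
      x + q * p       ∎)
      where open ≡-Reasoning
    p∣t : p ∣ t
    p∣t with euclidsLemma x t pp (divides q x*t≡q*p)
    ... | inj₁ p∣x = contradiction p∣x p∤x
    ... | inj₂ p∣t = p∣t

  1+multiple^ : ∀ r p n → ∃ λ s → (1 + r * p) ^ n ≡ 1 + s * p
  1+multiple^ r p zero = 0 , refl
  1+multiple^ r p (suc n) with 1+multiple^ r p n
  ... | s , e = r + s + r * s * p , trans (cong ((1 + r * p) *_) e) (expand r s p)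
    where
    expand : ∀ r s p → (1 + r * p) * (1 + s * p) ≡ 1 + (r + s + r * s * p) * p
    expand = solve-∀

  fermat-multiple : ∀ {p x} → Prime p → ¬ p ∣ x → ∀ n → ∃ λ s → x ^ ((p ∸ 1) * n) ≡ 1 + s * p
  fermat-multiple {p} {x} pp p∤x n with fermat-coprime pp p∤x
  ... | r , x^[p∸1]≡ with 1+multiple^ r p n
  ...   | s , e = s , trans (sym (^-*-assoc x (p ∸ 1) n)) (trans (cong (_^ n) x^[p∸1]≡) e)

module PeriodTwo where

  open import Data.List using (length; filter; upTo)
  open import Data.List.Properties using (filter-none)
  open import Data.List.Relation.Unary.All using (universal)
  open import Data.Nat
  open import Data.Nat.DivMod
  open import Data.Nat.Divisibility
  open import Data.Nat.Primality
  open import Data.Nat.Properties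
  open import Data.Product using (_×_; _,_)
  open import Function using (_∘_)
  open import Relation.Binary.PropositionalEquality
  open import Relation.Nullary using (¬_; ¬?; yes; no)
  open import Relation.Nullary.Decidable using (_×-dec_)
  open import Defs
  open Fermat

  module _ {p} (pp : Prime p) (ℓ c : ℕ) where

    private instance _ = prime⇒nonZero pp

    φ-divisible : ∀ {z} → p ∣ z → φ p ℓ c z % p ≡ c % p
    φ-divisible {z} p∣z = %-remove-+ˡ c (p∣z^e {(p ∸ 1) ^ ℓ} (m^n>0 (p ∸ 1) ℓ))
      where
      instance _ = >-nonZero (m<n⇒0<n∸m (1<prime pp))
      p∣z^e : ∀ {e} → 0 < e → p ∣ z ^ e
      p∣z^e {suc e} _ = ∣m⇒∣m*n (z ^ e) p∣z

    φ-coprime : 1 ≤ ℓ → ∀ {z} → ¬ p ∣ z → φ p ℓ c z % p ≡ suc c % p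
    φ-coprime (s≤s {n = ℓ′} _) p∤z with fermat-multiple pp p∤z ((p ∸ 1) ^ ℓ′)
    ... | s , z^e≡ = trans (cong (λ t → (t + c) % p) z^e≡)
                           (trans (cong (_% p) (rearrange s)) ([m+kn]%n≡m%n (suc c) s p))
      where
      rearrange : ∀ s → 1 + s * p + c ≡ suc c + s * p
      rearrange s = cong suc (+-comm (s * p) c)

    private
      ∣-resp-% : ∀ {x y} → x % p ≡ y % p → p ∣ x → p ∣ y
      ∣-resp-% {x} {y} x≡y p∣x = m%n≡0⇒n∣m y p (trans (sym x≡y) (n∣m⇒m%n≡0 x p p∣x))

    module _ (1≤ℓ : 1 ≤ ℓ) (p∤1+c : ¬ p ∣ suc c) where

      private
        f = φ p ℓ c

      no-primitive-2-cycle : ∀ z → ¬ (f z % p ≢ z % p × f (f z) % p ≡ z % p)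
      no-primitive-2-cycle z (fz≢z , ffz≡z) with p ∣? z
      ... | no p∤z = fz≢z (trans (φ-coprime 1≤ℓ p∤z) (trans (sym (φ-coprime 1≤ℓ p∤fz)) ffz≡z))
        where
        p∤fz : ¬ p ∣ f z
        p∤fz = p∤1+c ∘ ∣-resp-% (φ-coprime 1≤ℓ p∤z)
      ... | yes p∣z with p ∣? c
      ...   | yes p∣c =
        fz≢z (trans (φ-divisible p∣z) (trans (n∣m⇒m%n≡0 c p p∣c) (sym (n∣m⇒m%n≡0 z p p∣z))))
      ...   | no p∤c = p∤1+c (∣-resp-% (φ-coprime 1≤ℓ p∤fz) (∣-resp-% (sym ffz≡z) p∣z))
        where
        p∤fz : ¬ p ∣ f z
        p∤fz = p∤c ∘ ∣-resp-% (φ-divisible p∣z)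

  Y2≡0 : ∀ {p} → Prime p → ∀ {ℓ c} → 1 ≤ ℓ → ¬ p ∣ suc c → Y2 ℓ c p ≡ 0
  Y2≡0 {p@(suc _)} pp {ℓ} {c} 1≤ℓ p∤1+c =
    cong length (filter-none primitive-2-periodic? (universal (no-primitive-2-cycle pp ℓ c 1≤ℓ p∤1+c) (upTo p)))
    where
    primitive-2-periodic? = λ z → ¬? ((φ p ℓ c z % p) ≟ (z % p)) ×-dec ((φ p ℓ c (φ p ℓ c z) % p) ≟ (z % p))

module Counting where

  open import Data.List using ([]; _∷_; [_]; _++_; length; filter; upTo)
  open import Data.List.Properties using (upTo-∷ʳ; filter-++; length-++; length-filter; length-upTo; filter-reject)
  open import Data.List.Relation.Binary.Sublist.Propositional.Properties using (filter⁺; filter-⊆; length-mono-≤)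
  open import Data.List.Relation.Unary.All using (All; []; _∷_)
  open import Data.Nat
  open import Data.Nat.Properties
  open import Data.Sum using (_⊎_; inj₁; inj₂)
  open import Function using (id; _∘_)
  open import Level using (Level)
  open import Relation.Binary.PropositionalEquality hiding ([_])
  open import Relation.Nullary using (¬_; yes; no; contradiction)
  open import Relation.Unary using (Pred; Decidable)

  private
    variable
      a p q r : Level
      A : Set a

  module _ {P : Pred A p} {Q : Pred A q} (P? : Decidable P) (Q? : Decidable Q) where

    length-≤-filter-+-filter : ∀ {xs} → All (λ x → ¬ P x → Q x) xs →
                      length xs ≤ length (filter P? xs) + length (filter Q? xs)
    length-≤-filter-+-filter [] = z≤n
    length-≤-filter-+-filter {x ∷ xs} (¬P⇒Q ∷ rest) with ih ← length-≤-filter-+-filter rest | P? x | Q? x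
    ... | yes _ | yes _ = s≤s (≤-trans ih (+-monoʳ-≤ _ (n≤1+n _)))
    ... | yes _ | no _  = s≤s ih
    ... | no _  | yes _ = ≤-trans (s≤s ih) (≤-reflexive (sym (+-suc _ _)))
    ... | no ¬P | no ¬Q = contradiction (¬P⇒Q ¬P) ¬Q

    length-filter-filter : ∀ xs → length (filter P? (filter Q? xs)) ≤ length (filter P? xs)
    length-filter-filter xs = length-mono-≤ (filter⁺ P? P? (λ { refl → id }) (filter-⊆ Q? xs))

  module _ {P : Pred A p} {Q : Pred A q} {R : Pred A r} (P? : Decidable P) (Q? : Decidable Q) (R? : Decidable R)
           (P⇒Q⊎R : ∀ {x} → P x → Q x ⊎ R x) where

    length-filter-⊆-⊎ : ∀ xs → length (filter P? xs) ≤ length (filter Q? xs) + length (filter R? xs)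
    length-filter-⊆-⊎ [] = z≤n
    length-filter-⊆-⊎ (x ∷ xs) with ih ← length-filter-⊆-⊎ xs | P? x | Q? x | R? x
    ... | no _  | no _  | no _  = ih
    ... | no _  | no _  | yes _ = ≤-trans ih (+-monoʳ-≤ _ (n≤1+n _))
    ... | no _  | yes _ | no _  = ≤-trans ih (n≤1+n _)
    ... | no _  | yes _ | yes _ = ≤-trans ih (≤-trans (n≤1+n _) (s≤s (+-monoʳ-≤ _ (n≤1+n _))))
    ... | yes _ | yes _ | no _  = s≤s ih
    ... | yes _ | yes _ | yes _ = s≤s (≤-trans ih (+-monoʳ-≤ _ (n≤1+n _)))
    ... | yes _ | no _  | yes _ = ≤-trans (s≤s ih) (≤-reflexive (sym (+-suc _ _)))
    ... | yes Px | no ¬Q | no ¬R with P⇒Q⊎R Px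
    ...   | inj₁ Qx = contradiction Qx ¬Q
    ...   | inj₂ Rx = contradiction Rx ¬R

  module _ {P : Pred ℕ p} (P? : Decidable P) where

    count : ℕ → ℕ
    count n = length (filter P? (upTo n))

    count-suc : ∀ n → count (suc n) ≡ count n + length (filter P? [ n ])
    count-suc n = begin
      length (filter P? (upTo (suc n)))                     ≡⟨ cong (length ∘ filter P?) (sym (upTo-∷ʳ n)) ⟩
      length (filter P? (upTo n ++ [ n ]))                  ≡⟨ cong length (filter-++ P? (upTo n) [ n ]) ⟩
      length (filter P? (upTo n) ++ filter P? [ n ])        ≡⟨ length-++ (filter P? (upTo n)) ⟩
      count n + length (filter P? [ n ])                    ∎
      where open ≡-Reasoning

    count-reject : ∀ {n} → ¬ P n → count (suc n) ≡ count n
    count-reject {n} ¬Pn =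
      trans (count-suc n) (trans (cong (λ l → count n + length l) (filter-reject P? ¬Pn)) (+-identityʳ _))

    count≤ : ∀ n → count n ≤ n
    count≤ n = ≤-trans (length-filter P? (upTo n)) (≤-reflexive (length-upTo n))

    count-suc-≤ : ∀ n → count (suc n) ≤ suc (count n)
    count-suc-≤ n = ≤-trans (≤-reflexive (count-suc n))
                            (≤-trans (+-monoʳ-≤ (count n) (length-filter P? [ n ])) (≤-reflexive (+-comm (count n) 1)))

    count-mono : ∀ {m n} → m ≤ n → count m ≤ count n
    count-mono {n = zero}  z≤n = z≤n
    count-mono {n = suc n} m≤1+n with m≤n⇒m<n∨m≡n m≤1+n
    ... | inj₁ m<1+n =
      ≤-trans (count-mono (s≤s⁻¹ m<1+n)) (≤-trans (m≤m+n (count n) _) (≤-reflexive (sym (count-suc n))))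
    ... | inj₂ refl  = ≤-refl

  count-< : ∀ T n → count (_<? T) n ≤ T
  count-< T zero = z≤n
  count-< T (suc n) with n <? T
  ... | yes n<T = ≤-trans (count≤ (_<? T) (suc n)) n<T
  ... | no n≮T  = ≤-trans (≤-reflexive (count-reject (_<? T) n≮T)) (count-< T n)

module Erdős where

  open import Data.List using (List; []; _∷_; [_]; _++_; map; length; lookup; filter; upTo)
  open import Data.List.Membership.Propositional using (_∈_)
  open import Data.List.Membership.Propositional.Properties
    using (∈-map⁺; ∈-map⁻; ∈-++⁺ˡ; ∈-++⁺ʳ; ∈-++⁻; ∈-filter⁺; ∈-upTo⁺)
  open import Data.List.Properties using (length-++; length-map)
  open import Data.List.Relation.Unary.All using (_∷_)
  open import Data.List.Relation.Unary.Any using (here; there; index)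
  open import Data.List.Relation.Unary.Any.Properties using (lookup-index)
  open import Data.Nat
  open import Data.Nat.Divisibility
  open import Data.Nat.Induction using (<-rec)
  open import Data.Nat.Primality
  open import Data.Nat.ListAction using (product)
  open import Data.Nat.Primality.Factorisation using (factorise)
  open import Data.Nat.Properties
  open import Data.Nat.Tactic.RingSolver using (solve-∀)
  open import Data.Fin using (Fin; toℕ; fromℕ<; combine; remQuot)
  open import Data.Fin.Properties using (toℕ<n; toℕ-fromℕ<; toℕ-injective; remQuot-combine; injective⇒≤)
  open Counting using (count)
  open import Data.Product using (∃; ∃₂; _×_; _,_)
  open import Data.Sum using (inj₁; inj₂)
  open import Relation.Binary.PropositionalEquality hiding ([_])
  open import Relation.Nullary using (¬_; yes; no; contradiction)
  open import Function using (_∘_; it)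
  open Fermat using (1<prime)

  subsetProducts : List ℕ → List ℕ
  subsetProducts []       = [ 1 ]
  subsetProducts (q ∷ qs) = subsetProducts qs ++ map (q *_) (subsetProducts qs)

  length-subsetProducts : ∀ qs → length (subsetProducts qs) ≡ 2 ^ length qs
  length-subsetProducts []       = refl
  length-subsetProducts (q ∷ qs) = begin
    length (ss ++ map (q *_) ss)         ≡⟨ length-++ ss ⟩
    length ss + length (map (q *_) ss)   ≡⟨ cong (length ss +_) (length-map (q *_) ss) ⟩
    length ss + length ss                ≡⟨ cong (λ n → n + n) (length-subsetProducts qs) ⟩
    2 ^ length qs + 2 ^ length qs        ≡⟨ cong (2 ^ length qs +_) (sym (+-identityʳ _)) ⟩
    2 ^ length (q ∷ qs)                  ∎
    where
    open ≡-Reasoning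
    ss = subsetProducts qs

  1∈subsetProducts : ∀ qs → 1 ∈ subsetProducts qs
  1∈subsetProducts []       = here refl
  1∈subsetProducts (q ∷ qs) = ∈-++⁺ˡ (1∈subsetProducts qs)

  *-∈-subsetProducts : ∀ qs {p s} → s ∈ subsetProducts qs → p ∈ qs → ¬ p ∣ s → p * s ∈ subsetProducts qs
  *-∈-subsetProducts (q ∷ qs) s∈ (here refl) p∤s with ∈-++⁻ (subsetProducts qs) s∈
  ... | inj₁ s∈ss = ∈-++⁺ʳ (subsetProducts qs) (∈-map⁺ (q *_) s∈ss)
  ... | inj₂ s∈qss with ∈-map⁻ (q *_) s∈qss
  ...   | s′ , _ , refl = contradiction (m∣m*n s′) p∤s
  *-∈-subsetProducts (q ∷ qs) {p} s∈ (there p∈qs) p∤s with ∈-++⁻ (subsetProducts qs) s∈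
  ... | inj₁ s∈ss = ∈-++⁺ˡ (*-∈-subsetProducts qs s∈ss p∈qs p∤s)
  ... | inj₂ s∈qss with ∈-map⁻ (q *_) s∈qss
  ...   | s′ , s′∈ss , refl =
    ∈-++⁺ʳ (subsetProducts qs)
      (subst (_∈ map (q *_) (subsetProducts qs)) (swap q p s′)
        (∈-map⁺ (q *_) (*-∈-subsetProducts qs s′∈ss p∈qs (p∤s ∘ ∣n⇒∣m*n q))))
    where
    swap : ∀ q p s → q * (p * s) ≡ p * (q * s)
    swap = solve-∀

  prime-divisor : ∀ {n} → 1 < n → ∃ λ p → Prime p × p ∣ n
  prime-divisor {n@(suc _)} 1<n with factorise n
  ... | record { factors = [] ; isFactorisation = n≡1 } = contradiction n≡1 (>⇒≢ 1<n)
  ... | record { factors = p ∷ ps ; isFactorisation = n≡p*ps ; factorsPrime = pp ∷ _ } =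
    p , pp , divides (product ps) (trans n≡p*ps (*-comm p (product ps)))

  private
    nonZero-factor : ∀ {n a b} .{{_ : NonZero n}} → n ≡ a * b → NonZero a
    nonZero-factor {n} {a} {b} n≡a*b = m*n≢0⇒m≢0 a {b} {{subst NonZero n≡a*b it}}

    factor< : ∀ {n a b} .{{_ : NonZero n}} → n ≡ a * b → 1 < b → a < n
    factor< {n} {a} {b} n≡a*b 1<b = subst (a <_) (sym n≡a*b) (m<m*n a b {{nonZero-factor n≡a*b}} 1<b)

    square-part-bound : ∀ {n a s B} → .{{NonZero n}} → n ≤ B * B → n ≡ a * a * s → 0 < a × a ≤ B
    square-part-bound {n} {a} {s} {B} n≤B² n≡a*a*s = 0<a , ≮⇒≥ B≮a
      where
      instance
        _ = nonZero-factor (trans n≡a*a*s (*-assoc a a s))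
        _ = m*n≢0⇒n≢0 (a * a) {{subst NonZero n≡a*a*s it}}
      0<a = >-nonZero⁻¹ a
      B≮a : ¬ B < a
      B≮a B<a = <⇒≱ (*-mono-< B<a B<a) (≤-trans (m≤m*n (a * a) s) (≤-trans (≤-reflexive (sym n≡a*a*s)) n≤B²))

  module _ (qs : List ℕ) where

    SquareTimesSubsetProduct : ℕ → Set
    SquareTimesSubsetProduct n = ∃₂ λ a s → s ∈ subsetProducts qs × n ≡ a * a * s

    private
      absorb-square : ∀ {n k p} → n ≡ k * (p * p) → SquareTimesSubsetProduct k → SquareTimesSubsetProduct n
      absorb-square {n} {k} {p} n≡k*p² (a , s , s∈ , k≡a*a*s) =
        p * a , s , s∈ , trans n≡k*p² (trans (cong (_* (p * p)) k≡a*a*s) (rearrange a s p))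
        where
        rearrange : ∀ a s p → a * a * s * (p * p) ≡ p * a * (p * a) * s
        rearrange = solve-∀

      absorb-prime : ∀ {n m p} → p ∈ qs → ¬ p ∣ m → n ≡ m * p →
                     SquareTimesSubsetProduct m → SquareTimesSubsetProduct n
      absorb-prime {n} {m} {p} p∈qs p∤m n≡m*p (a , s , s∈ , m≡a*a*s) =
        a , p * s , *-∈-subsetProducts qs s∈ p∈qs p∤s , trans n≡m*p (trans (cong (_* p) m≡a*a*s) (rearrange a s p))
        where
        p∤s : ¬ p ∣ s
        p∤s p∣s = p∤m (∣-trans p∣s (divides (a * a) m≡a*a*s))
        rearrange : ∀ a s p → a * a * s * p ≡ a * a * (p * s)
        rearrange = solve-∀

    square*subsetProduct : ∀ n → .{{NonZero n}} → (∀ {p} → Prime p → p ∣ n → p ∈ qs) →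
                           SquareTimesSubsetProduct n
    square*subsetProduct = <-rec Goal decompose
      where
      Goal : ℕ → Set
      Goal n = .{{NonZero n}} → (∀ {p} → Prime p → p ∣ n → p ∈ qs) → SquareTimesSubsetProduct n
      decompose : ∀ n → (∀ {m} → m < n → Goal m) → Goal n
      decompose 1 _ _ = 1 , 1 , 1∈subsetProducts qs , refl
      decompose n@(suc (suc _)) rec ∣n⇒∈ with prime-divisor {n} (s≤s (s≤s z≤n))
      ... | p , pp , p∣n@(divides m n≡m*p) with p ∣? m
      ...   | yes (divides k m≡k*p) = absorb-square {p = p} n≡k*p²
              (rec (factor< n≡k*p² 1<p²) {{nonZero-factor n≡k*p²}} (λ qp q∣k → ∣n⇒∈ qp (∣-trans q∣k k∣n)))
        where
        n≡k*p² = trans n≡m*p (trans (cong (_* p) m≡k*p) (*-assoc k p p))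
        1<p² = ≤-trans (1<prime pp) (m≤m*n p p {{prime⇒nonZero pp}})
        k∣n = divides (p * p) (trans n≡k*p² (*-comm k (p * p)))
      ...   | no p∤m = absorb-prime (∣n⇒∈ pp p∣n) p∤m n≡m*p
              (rec (factor< n≡m*p (1<prime pp)) {{nonZero-factor n≡m*p}} (λ qp q∣m → ∣n⇒∈ qp (∣-trans q∣m m∣n)))
        where
        m∣n = divides p (trans n≡m*p (*-comm m p))

  module _ (qs : List ℕ) {B : ℕ} where

    private
      L = subsetProducts qs

    encode : ∀ {n} .{{_ : NonZero n}} → n ≤ B * B → SquareTimesSubsetProduct qs n → Fin (B * length L)
    encode n≤B² (a , s , s∈L , n≡a*a*s) with square-part-bound {a = a} {s} {B} n≤B² n≡a*a*s
    ... | 0<a , a≤B = combine (fromℕ< (pred-mono-< {{>-nonZero 0<a}} (s≤s a≤B))) (index s∈L)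

    private
      square-times : Fin B × Fin (length L) → ℕ
      square-times (u , v) = suc (toℕ u) * suc (toℕ u) * lookup L v

    decode : Fin (B * length L) → ℕ
    decode = square-times ∘ remQuot {B} (length L)

    decode-encode : ∀ {n} .{{_ : NonZero n}} (n≤B² : n ≤ B * B) (d : SquareTimesSubsetProduct qs n) →
                    decode (encode n≤B² d) ≡ n
    decode-encode n≤B² (a , s , s∈L , n≡a*a*s) with square-part-bound {a = a} {s} {B} n≤B² n≡a*a*s
    ... | 0<a , a≤B = begin
      square-times (remQuot (length L) (combine u (index s∈L)))  ≡⟨ cong square-times (remQuot-combine u (index s∈L)) ⟩
      suc (toℕ u) * suc (toℕ u) * lookup L (index s∈L)          ≡⟨ cong₂ (λ b t → b * b * t) suc-u≡a (sym (lookup-index s∈L)) ⟩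
      a * a * s                                                  ≡⟨ sym n≡a*a*s ⟩
      _                                                          ∎
      where
      open ≡-Reasoning
      instance _ = >-nonZero 0<a
      u = fromℕ< (pred-mono-< (s≤s a≤B))
      suc-u≡a : suc (toℕ u) ≡ a
      suc-u≡a = trans (cong suc (toℕ-fromℕ< _)) (suc-pred a)

    decomposable-count : ∀ {x} → x ≤ B * B → ((i : Fin x) → SquareTimesSubsetProduct qs (suc (toℕ i))) →
                         x ≤ B * length L
    decomposable-count {x} x≤B² decomposition = injective⇒≤ code-injective
      where
      code : Fin x → Fin (B * length L)
      code i = encode (≤-trans (toℕ<n i) x≤B²) (decomposition i)
      decode-code : ∀ i → decode (code i) ≡ suc (toℕ i)
      decode-code i = decode-encode (≤-trans (toℕ<n i) x≤B²) (decomposition i)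
      code-injective : ∀ {i j} → code i ≡ code j → i ≡ j
      code-injective {i} {j} ci≡cj =
        toℕ-injective (suc-injective (trans (sym (decode-code i)) (trans (cong decode ci≡cj) (decode-code j))))

  π : ℕ → ℕ
  π x = count prime? (suc x)

  private
    2^m*2^m≡4^m : ∀ m → 2 ^ m * 2 ^ m ≡ 4 ^ m
    2^m*2^m≡4^m zero    = refl
    2^m*2^m≡4^m (suc m) = trans (rearrange (2 ^ m)) (cong (4 *_) (2^m*2^m≡4^m m))
      where
      rearrange : ∀ b → 2 * b * (2 * b) ≡ 4 * (b * b)
      rearrange = solve-∀

    2^-cancel-≤ : ∀ {m n} → 2 ^ m ≤ 2 ^ n → m ≤ n
    2^-cancel-≤ 2^m≤2^n = ≮⇒≥ (λ n<m → <⇒≱ (^-monoʳ-< 2 (s≤s (s≤s z≤n)) n<m) 2^m≤2^n)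

  π[4^m]≥m : ∀ m → m ≤ π (4 ^ m)
  π[4^m]≥m m = subst (λ x → m ≤ π x) (2^m*2^m≡4^m m) (2^-cancel-≤ B≤2^π)
    where
    B = 2 ^ m
    ps = filter prime? (upTo (suc (B * B)))
    all-decomposable : (i : Fin (B * B)) → SquareTimesSubsetProduct ps (suc (toℕ i))
    all-decomposable i = square*subsetProduct ps (suc (toℕ i))
      (λ pp p∣n → ∈-filter⁺ prime? (∈-upTo⁺ (s≤s (≤-trans (∣⇒≤ p∣n) (toℕ<n i)))) pp)
    B≤2^π : B ≤ 2 ^ length ps
    B≤2^π = *-cancelˡ-≤ B {{m^n≢0 2 m}}
      (≤-trans (decomposable-count ps {B} ≤-refl all-decomposable) (≤-reflexive (cong (B *_) (length-subsetProducts ps))))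

module PrimeDivisors where

  open import Data.List using ([]; _∷_; length)
  open import Data.List.Relation.Unary.All using (All; []; _∷_)
  open import Data.List.Relation.Unary.Unique.Propositional using (Unique; []; _∷_)
  open import Data.Nat
  open import Data.Nat.Divisibility
  open import Data.Nat.ListAction using (product)
  open import Data.Nat.Primality
  open import Data.Nat.Properties
  open import Data.Sum using (inj₁; inj₂)
  open import Relation.Binary.PropositionalEquality
  open import Relation.Nullary using (¬_; contradiction)
  open Fermat using (1<prime)

  prime∣prime⇒≡ : ∀ {p q} → Prime p → Prime q → p ∣ q → p ≡ q
  prime∣prime⇒≡ pp pq p∣q with prime⇒irreducible pq p∣q
  ... | inj₁ p≡1 = contradiction p≡1 (>⇒≢ (1<prime pp))
  ... | inj₂ p≡q = p≡q

  ∣-cancel-prime : ∀ {p q n} → Prime p → Prime q → p ≢ q → q ∣ n * p → q ∣ n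
  ∣-cancel-prime {n = n} pp pq p≢q q∣n*p with euclidsLemma n _ pq q∣n*p
  ... | inj₁ q∣n = q∣n
  ... | inj₂ q∣p = contradiction (sym (prime∣prime⇒≡ pq pp q∣p)) p≢q

  product-primes-∣ : ∀ {ps n} → Unique ps → All Prime ps → All (_∣ n) ps → product ps ∣ n
  product-primes-∣ {[]} {n} [] [] [] = 1∣ n
  product-primes-∣ {p ∷ ps} (p∉ps ∷ uniq) (pp ∷ pps) (divides m refl ∷ ps∣n) =
    subst (p * product ps ∣_) (*-comm p m) (*-monoʳ-∣ p (product-primes-∣ uniq pps (divide-out p∉ps pps ps∣n)))
    where
    divide-out : ∀ {qs} → All (p ≢_) qs → All Prime qs → All (_∣ m * p) qs → All (_∣ m) qs
    divide-out [] [] [] = []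
    divide-out (p≢q ∷ p≢qs) (pq ∷ pqs) (q∣ ∷ qs∣) = ∣-cancel-prime pp pq p≢q q∣ ∷ divide-out p≢qs pqs qs∣

  ^length≤product : ∀ {m ps} → All (m ≤_) ps → m ^ length ps ≤ product ps
  ^length≤product []             = ≤-refl
  ^length≤product (m≤p ∷ m≤ps) = *-mono-≤ m≤p (^length≤product m≤ps)

module Density where

  open import Data.List using (List; length; filter; upTo)
  open import Data.List.Properties using (length-filter)
  open import Data.List.Relation.Unary.All as All using (All)
  open import Data.List.Relation.Unary.All.Properties using (all-filter)
  import Data.List.Relation.Unary.All.Properties as All
  open import Data.List.Relation.Unary.Unique.Propositional using (Unique)
  import Data.List.Relation.Unary.Unique.Propositional.Properties as Unique
  open import Data.Nat
  open import Data.Nat.Divisibility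
  open import Data.Nat.Primality
  open import Data.Nat.Properties
  open import Data.Nat.Tactic.RingSolver using (solve-∀)
  open import Data.Product using (∃; _×_; _,_; proj₁; proj₂)
  open import Data.Sum using (_⊎_; inj₁; inj₂)
  open import Relation.Binary.PropositionalEquality
  open import Relation.Nullary using (yes; no)
  open import Relation.Nullary.Decidable using (_×-dec_; decidable-stable)
  open import Defs
  open Counting
  open Erdős using (π; π[4^m]≥m)
  open PrimeDivisors using (product-primes-∣; ^length≤product)
  open PeriodTwo using (Y2≡0)

  K*x<d : ∀ {K T j d x} → x ≤ T + j → 2 * K * j ≤ d + 6 → 2 * K * T + 7 ≤ d → K * x < d
  K*x<d {K} {T} {j} {d} {x} x≤T+j 2Kj≤d+6 2KT+7≤d = *-cancelˡ-< 2 (K * x) d (begin-strict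
    2 * (K * x)             ≤⟨ *-monoʳ-≤ 2 (*-monoʳ-≤ K x≤T+j) ⟩
    2 * (K * (T + j))       ≡⟨ expand K T j ⟩
    2 * K * T + 2 * K * j   ≤⟨ +-monoʳ-≤ (2 * K * T) 2Kj≤d+6 ⟩
    2 * K * T + (d + 6)     <⟨ ≤-reflexive (shift (2 * K * T) d) ⟩
    2 * K * T + 7 + d       ≤⟨ +-monoˡ-≤ d 2KT+7≤d ⟩
    d + d                   ≡⟨ cong (d +_) (sym (+-identityʳ d)) ⟩
    2 * d                   ∎)
    where
    open ≤-Reasoning
    expand : ∀ K T j → 2 * (K * (T + j)) ≡ 2 * K * T + 2 * K * j
    expand = solve-∀
    shift : ∀ a d → suc (a + (d + 6)) ≡ a + 7 + d
    shift = solve-∀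

  module _ (c : ℕ) where

    private
      N = suc c
      isPrime≥5? = λ p → prime? p ×-dec (5 ≤? p)

      all-prime≥5 : All (λ p → Prime p × 5 ≤ p) (primesIn5c c)
      all-prime≥5 = all-filter isPrime≥5? (upTo (suc c))

      large? = λ T p → T ≤? p ×-dec p ∣? N

    primeDivisors : List ℕ
    primeDivisors = filter (_∣? N) (primesIn5c c)

    largePrimeDivisors : ℕ → List ℕ
    largePrimeDivisors T = filter (large? T) (primesIn5c c)

    denom≤numer+primeDivisors : ∀ {ℓ} → 1 ≤ ℓ → denom c ≤ numer ℓ c + length primeDivisors
    denom≤numer+primeDivisors {ℓ} 1≤ℓ = length-≤-filter-+-filter (λ p → Y2 ℓ c p ≟ 0) (_∣? N)
      (All.map (λ (pp , _) Y2≢0 → decidable-stable (_ ∣? N) (λ p∤N → Y2≢0 (Y2≡0 pp 1≤ℓ p∤N))) all-prime≥5)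

    primeDivisors≤T+large : ∀ T → length primeDivisors ≤ T + length (largePrimeDivisors T)
    primeDivisors≤T+large T = ≤-trans (length-filter-⊆-⊎ (_∣? N) (_<? T) (large? T) split (primesIn5c c))
                                      (+-monoˡ-≤ (length (largePrimeDivisors T)) small≤T)
      where
      split : ∀ {p} → p ∣ N → p < T ⊎ (T ≤ p × p ∣ N)
      split {p} p∣N with p <? T
      ... | yes p<T = inj₁ p<T
      ... | no p≮T  = inj₂ (≮⇒≥ p≮T , p∣N)
      small≤T : length (filter (_<? T) (primesIn5c c)) ≤ T
      small≤T = ≤-trans (length-filter-filter (_<? T) isPrime≥5? (upTo (suc c))) (count-< T (suc c))

    T^large≤N : ∀ T → T ^ length (largePrimeDivisors T) ≤ N
    T^large≤N T = ≤-trans (^length≤product (All.map proj₁ all-large))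
                          (∣⇒≤ (product-primes-∣ unique all-prime (All.map proj₂ all-large)))
      where
      all-large = all-filter (large? T) (primesIn5c c)
      unique : Unique (largePrimeDivisors T)
      unique = Unique.filter⁺ (large? T) (Unique.filter⁺ isPrime≥5? (Unique.upTo⁺ (suc c)))
      all-prime : All Prime (largePrimeDivisors T)
      all-prime = All.filter⁺ (large? T) (All.map proj₁ all-prime≥5)

    t*large≤π : ∀ t → t * length (largePrimeDivisors (4 ^ t)) ≤ π N
    t*large≤π t = ≤-trans (π[4^m]≥m (t * j)) (count-mono prime? (s≤s 4^tj≤N))
      where
      j = length (largePrimeDivisors (4 ^ t))
      4^tj≤N : 4 ^ (t * j) ≤ N
      4^tj≤N = subst (_≤ N) (^-*-assoc 4 t j) (T^large≤N (4 ^ t))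

    π≤denom+5 : π c ≤ denom c + 5
    π≤denom+5 = ≤-trans (length-filter-⊆-⊎ prime? isPrime≥5? (_<? 5) split (upTo (suc c)))
                        (+-monoʳ-≤ (denom c) (count-< 5 (suc c)))
      where
      split : ∀ {p} → Prime p → (Prime p × 5 ≤ p) ⊎ p < 5
      split {p} pp with 5 ≤? p
      ... | yes 5≤p = inj₁ (pp , 5≤p)
      ... | no 5≰p  = inj₂ (≰⇒> 5≰p)

    π[N]≤denom+6 : π N ≤ denom c + 6
    π[N]≤denom+6 = ≤-trans (count-suc-≤ prime? (suc c)) (≤-trans (s≤s π≤denom+5) (≤-reflexive (sym (+-suc (denom c) 5))))

  density-bound : ∀ ℓ → 1 ≤ ℓ → ∀ K → ∃ λ N → ∀ c → c ≥ N → K * (denom c ∸ numer ℓ c) < denom c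
  density-bound ℓ 1≤ℓ K = 4 ^ H , λ c 4^H≤c →
    K*x<d {K} {T} (missing≤T+large c) (2K*large≤denom+6 c) (2KT+7≤denom c 4^H≤c)
    where
    T = 4 ^ (2 * K)
    H = 2 * K * T + 7 + 5
    missing≤T+large : ∀ c → denom c ∸ numer ℓ c ≤ T + length (largePrimeDivisors c T)
    missing≤T+large c = ≤-trans (m≤n+o⇒m∸n≤o (denom c) (numer ℓ c) (denom≤numer+primeDivisors c 1≤ℓ))
                                (primeDivisors≤T+large c T)
    2K*large≤denom+6 : ∀ c → 2 * K * length (largePrimeDivisors c T) ≤ denom c + 6
    2K*large≤denom+6 c = ≤-trans (t*large≤π c (2 * K)) (π[N]≤denom+6 c)
    2KT+7≤denom : ∀ c → 4 ^ H ≤ c → 2 * K * T + 7 ≤ denom c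
    2KT+7≤denom c 4^H≤c = +-cancelʳ-≤ 5 _ _ (begin
      H          ≤⟨ π[4^m]≥m H ⟩
      π (4 ^ H)  ≤⟨ count-mono prime? (s≤s 4^H≤c) ⟩
      π c        ≤⟨ π≤denom+5 c ⟩
      denom c + 5 ∎)
      where open ≤-Reasoning

  numer≤denom : ∀ ℓ c → numer ℓ c ≤ denom c
  numer≤denom ℓ c = length-filter (λ p → Y2 ℓ c p ≟ 0) (primesIn5c c)

module DistanceToOne where

  open import Data.Integer as ℤ using (+_; +[1+_]; +<+)
  import Data.Integer.Properties as ℤ
  open import Data.Nat as ℕ using (ℕ; suc; _∸_)
  import Data.Nat.Properties as ℕ
  open import Data.Nat.Coprimality using (Coprime)
  open import Data.Rational using (mkℚ; _/_; _-_; ∣_∣; _<_; 1ℚ; toℚᵘ)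
  open import Data.Rational.Properties using (toℚᵘ-cancel-<; toℚᵘ-homo-∣-∣; toℚᵘ-homo-+; toℚᵘ-fromℚᵘ)
  open import Data.Rational.Unnormalised as ℚᵘ using (ℚᵘ; mkℚᵘ; *<*; 1ℚᵘ)
  import Data.Rational.Unnormalised.Properties as ℚᵘ
  open import Relation.Binary.PropositionalEquality

  ∣a/b-1∣<ε : ∀ a b .{{_ : ℕ.NonZero b}} k d .(cop : Coprime (suc k) (suc d)) →
              a ℕ.≤ b → suc d ℕ.* (b ∸ a) ℕ.< b → ∣ + a / b - 1ℚ ∣ < mkℚ +[1+ k ] d cop
  ∣a/b-1∣<ε a b@(suc b′) k d cop a≤b d*[b∸a]<b =
    toℚᵘ-cancel-< (ℚᵘ.<-respˡ-≃ (ℚᵘ.≃-sym toℚᵘ-distance) (*<* cross))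
    where
    distance : ℚᵘ
    distance = ℚᵘ.∣ mkℚᵘ (+ a) b′ ℚᵘ.- 1ℚᵘ ∣
    toℚᵘ-distance : toℚᵘ ∣ + a / b - 1ℚ ∣ ℚᵘ.≃ distance
    toℚᵘ-distance = ℚᵘ.≃-trans (toℚᵘ-homo-∣-∣ (+ a / b - 1ℚ))
      (ℚᵘ.∣-∣-cong (ℚᵘ.≃-trans (toℚᵘ-homo-+ (+ a / b) _)
                               (ℚᵘ.+-cong (toℚᵘ-fromℚᵘ (mkℚᵘ (+ a) b′)) ℚᵘ.≃-refl)))
    ↥distance : ℚᵘ.↥ distance ≡ + (b ∸ a)
    ↥distance = trans (cong (λ i → + ℤ.∣ i ∣) numerator≡) (cong +_ (ℤ.∣⊖∣-≤ a≤b))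
      where
      open ≡-Reasoning
      numerator≡ : + a ℤ.* + 1 ℤ.+ ℤ.- + 1 ℤ.* + b ≡ a ℤ.⊖ b
      numerator≡ = begin
        + a ℤ.* + 1 ℤ.+ ℤ.- + 1 ℤ.* + b  ≡⟨ cong₂ ℤ._+_ (ℤ.*-identityʳ (+ a)) (ℤ.-1*i≡-i (+ b)) ⟩
        + a ℤ.- + b                      ≡⟨ ℤ.m-n≡m⊖n a b ⟩
        a ℤ.⊖ b                          ∎
    cross : ℚᵘ.↥ distance ℤ.* + suc d ℤ.< +[1+ k ] ℤ.* + (b ℕ.* 1)
    cross = subst (λ i → i ℤ.* + suc d ℤ.< +[1+ k ] ℤ.* + (b ℕ.* 1)) (sym ↥distance)
      (subst₂ ℤ._<_ (ℤ.pos-* (b ∸ a) (suc d)) (ℤ.pos-* (suc k) (b ℕ.* 1)) (+<+ (begin-strict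
        (b ∸ a) ℕ.* suc d     ≡⟨ ℕ.*-comm (b ∸ a) (suc d) ⟩
        suc d ℕ.* (b ∸ a)     <⟨ d*[b∸a]<b ⟩
        b                     ≡⟨ sym (ℕ.*-identityʳ b) ⟩
        b ℕ.* 1               ≤⟨ ℕ.m≤n*m (b ℕ.* 1) (suc k) ⟩
        suc k ℕ.* (b ℕ.* 1)   ∎)))
      where open ℕ.≤-Reasoning

open import Defs
open import Data.Nat as ℕ using (ℕ; _≥_; zero; suc)
open import Data.Integer using (+_; +[1+_]; -[1+_]; +<+)
open import Data.Rational using (ℚ; mkℚ; *<*; _/_; _-_; ∣_∣; _<_; 0ℚ; 1ℚ)
open import Data.Product using (∃; _,_; proj₁; proj₂)
open Density using (density-bound; numer≤denom)
open DistanceToOne using (∣a/b-1∣<ε)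

corollary10p2 : (ℓ : ℕ) → 1 ℕ.≤ ℓ →
    (ε : ℚ) → 0ℚ < ε →
      ∃ λ (N : ℕ) → (c : ℕ) → c ≥ N → .{{_ : ℕ.NonZero (denom c)}} →
        ∣ (+ numer ℓ c / denom c) - 1ℚ ∣ < ε
corollary10p2 ℓ 1≤ℓ (mkℚ +[1+ k ] d cop) _ = proj₁ bound , λ c c≥N →
  ∣a/b-1∣<ε (numer ℓ c) (denom c) k d cop (numer≤denom ℓ c) (proj₂ bound c c≥N)
  where
  bound = density-bound ℓ 1≤ℓ (suc d)
corollary10p2 ℓ 1≤ℓ (mkℚ (+ zero) d cop) (*<* (+<+ ()))
corollary10p2 ℓ 1≤ℓ (mkℚ -[1+ n ] d cop) (*<* ())
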